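{- If $G$ is a connected VC-irreducible graph, then every graph in $\mathrm{Par}(G)$ is connected and VC-irreducible.
   Context: A vertex cover is a set of vertices meeting every edge. A connected graph $G=(V,E)$ is VC-irreducible if for every edge $e\in E$ the graph $(V,E\setminus\{e\})$ has strictly smaller minimum vertex cover size than $G$. For $G=(V,E)$, $\mathrm{Par}(G)$ is the set of graphs obtained from $G$ by adding a new vertex $u\notin V$ and the edges $\{\{u,v'\}: v'\in N_G(v)\cup\{v\}\}$ for some vertex $v\in V$, where $N_G(v)$ denotes the neighborhood of $v$. -}

module Defs where

open import Data.Nat using (ℕ; suc; _≤_; _<_)
open import Data.Bool using (Bool; true; false; _∧_; _∨_; not)
open import Data.Fin using (Fin; zero; suc; _≟_)
open import Data.Fin.Subset using (Subset; _∈_; ∣_∣)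
open import Data.Product using (Σ; _×_; _,_)
open import Data.Sum using (_⊎_)
open import Relation.Nullary.Decidable using (⌊_⌋)
open import Relation.Binary.PropositionalEquality using (_≡_)
open import Relation.Binary.Construct.Closure.ReflexiveTransitive using (Star)

Adj : ℕ → Set
Adj n = Fin n → Fin n → Bool

record Graph (n : ℕ) : Set where
  field
    adj   : Adj n
    sym   : ∀ x y → adj x y ≡ adj y x
    irref : ∀ x → adj x x ≡ false
open Graph public

Edge : ∀ {n} → Adj n → Fin n → Fin n → Set
Edge A x y = A x y ≡ true

Connected : ∀ {n} → Adj n → Set
Connected {n} A = ∀ (x y : Fin n) → Star (Edge A) x y

IsVertexCover : ∀ {n} → Adj n → Subset n → Set
IsVertexCover A C = ∀ x y → Edge A x y → (x ∈ C) ⊎ (y ∈ C)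

IsMinVCSize : ∀ {n} → Adj n → ℕ → Set
IsMinVCSize {n} A k =
  (Σ (Subset n) λ C → IsVertexCover A C × ∣ C ∣ ≡ k)
  × (∀ (C : Subset n) → IsVertexCover A C → k ≤ ∣ C ∣)

removeEdge : ∀ {n} → Adj n → Fin n → Fin n → Adj n
removeEdge A a b x y =
  A x y ∧ not ((⌊ x ≟ a ⌋ ∧ ⌊ y ≟ b ⌋) ∨ (⌊ x ≟ b ⌋ ∧ ⌊ y ≟ a ⌋))

-- VC-irreducible (includes connectedness, as in the paper's definition):
-- deleting any edge strictly decreases the minimum vertex cover size.
VCIrreducible : ∀ {n} → Adj n → Set
VCIrreducible {n} A =
  Connected A ×
  (∀ (a b : Fin n) → Edge A a b → ∀ (k k′ : ℕ) →
     IsMinVCSize A k → IsMinVCSize (removeEdge A a b) k′ → k′ < k)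

-- Par: add a new vertex u (here: zero; old vertex i becomes suc i)
-- adjacent exactly to N_G(v) ∪ {v}.
parAdj : ∀ {n} → Adj n → Fin n → Adj (suc n)
parAdj A v zero    zero    = false
parAdj A v zero    (suc j) = A v j ∨ ⌊ j ≟ v ⌋
parAdj A v (suc i) zero    = A v i ∨ ⌊ i ≟ v ⌋
parAdj A v (suc i) (suc j) = A i j

-- Write u for the new vertex, a copy of v adjacent to N[v]. Every cover of Par(G)
-- either contains u, and then restricts to a cover of G, or contains N[v], and then
-- stays a cover of G after dropping v; so τ(Par(G)) ≥ τ(G) + 1. For each edge e of
-- Par(G) we exhibit a cover of Par(G) − e with τ(G) vertices. If e lies in G, add u
-- to a cover of G − e of size τ(G) − 1. If e = uv' with v' ∈ N[v], take a neighbour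
-- w of v (w = v' when v' ≠ v) and a cover D of G − vw of size τ(G) − 1: by minimality
-- D avoids v and w, hence contains N(v) ∖ {w}, and D plus the other endpoint of vw
-- covers G and every edge at u except uv'.
module Submission where

open import Defs hiding (sym)
open import Data.Bool using (true; false; _∧_; _∨_; not)
import Data.Bool.Properties as Bool
open import Data.Fin using (Fin; zero; suc; _≟_)
open import Data.Fin.Properties using (all?; any?)
open import Data.Vec using ([]; _∷_; here; there)
open import Data.Fin.Subset
  using (Subset; _∈_; _∉_; _⊆_; _∪_; _-_; ⁅_⁆; ∣_∣; ⊤; inside; outside)
open import Data.Fin.Subset.Properties
  using (_∈?_; anySubset?; ∈⊤; ∣⊤∣≡n; drop-there; p⊆p∪q; q⊆p∪q; x∈⁅x⁆; ∣⁅x⁆∣≡1;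
         ∣p∣≤∣x∷p∣; x∈p∧x≢y⇒x∈p-y; x∈p⇒∣p-x∣<∣p∣)
open import Data.Nat using (ℕ; zero; suc; _+_; _≤_; _<_; z≤n; s≤s; _≤?_)
open import Data.Nat.Properties
  using (≤-trans; ≤-reflexive; ≤-<-trans; <-≤-trans; ≤⇒≯; ≰⇒>; +-suc; +-comm; +-monoʳ-≤)
open import Data.Product using (Σ; Σ-syntax; _×_; _,_; proj₁; proj₂)
import Data.Product as Product
open import Data.Sum using (_⊎_; inj₁; inj₂; [_,_]′) renaming (swap to ⊎-swap)
import Data.Sum as Sum
open import Function using (id; _∘_)
open import Relation.Nullary using (¬_; Dec; yes; no; does; contradiction)
open import Relation.Nullary.Decidable using (_×-dec_; _⊎-dec_; _→-dec_; isYes≗does)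
open import Relation.Binary.PropositionalEquality
  using (_≡_; _≢_; refl; sym; trans; cong; cong₂; subst)
open import Relation.Binary.Construct.Closure.ReflexiveTransitive
  using (ε; _◅_; _◅◅_; gmap)

private
  variable
    n : ℕ
    a b s t v w x y : Fin n
    A : Adj n
    C D : Subset n
    k : ℕ

SameEdge : Fin n → Fin n → Fin n → Fin n → Set
SameEdge a b x y = (x ≡ a × y ≡ b) ⊎ (x ≡ b × y ≡ a)

sameEdge? : (a b x y : Fin n) → Dec (SameEdge a b x y)
sameEdge? a b x y = (x ≟ a ×-dec y ≟ b) ⊎-dec (x ≟ b ×-dec y ≟ a)

SameEdge-others : SameEdge a b x y → s ≢ x → s ≢ y → s ≢ a × s ≢ b
SameEdge-others (inj₁ (refl , refl)) s≢x s≢y = s≢x , s≢y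
SameEdge-others (inj₂ (refl , refl)) s≢x s≢y = s≢y , s≢x

removeEdge-≡ : (A : Adj n) (a b x y : Fin n) →
               removeEdge A a b x y ≡ A x y ∧ not (does (sameEdge? a b x y))
removeEdge-≡ A a b x y = cong (λ same → A x y ∧ not same)
  (cong₂ _∨_ (cong₂ _∧_ (isYes≗does (x ≟ a)) (isYes≗does (y ≟ b)))
             (cong₂ _∧_ (isYes≗does (x ≟ b)) (isYes≗does (y ≟ a))))

∧-not-true⁻ : ∀ {P : Set} b (p? : Dec P) → b ∧ not (does p?) ≡ true → b ≡ true × ¬ P
∧-not-true⁻ true  (no ¬p) refl = refl , ¬p
∧-not-true⁻ true  (yes _) ()
∧-not-true⁻ false _       ()

∧-not-true⁺ : ∀ {P : Set} {b} (p? : Dec P) → b ≡ true → ¬ P → b ∧ not (does p?) ≡ true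
∧-not-true⁺ (yes p) _    ¬p = contradiction p ¬p
∧-not-true⁺ (no _)  refl _  = refl

Edge-removeEdge⁻ : ∀ (A : Adj n) a b x y → Edge (removeEdge A a b) x y →
                   Edge A x y × ¬ SameEdge a b x y
Edge-removeEdge⁻ A a b x y e =
  ∧-not-true⁻ (A x y) (sameEdge? a b x y) (trans (sym (removeEdge-≡ A a b x y)) e)

Edge-removeEdge⁺ : ∀ (A : Adj n) → Edge A x y → ¬ SameEdge a b x y →
                   Edge (removeEdge A a b) x y
Edge-removeEdge⁺ {x = x} {y = y} {a = a} {b = b} A e ¬same =
  trans (removeEdge-≡ A a b x y) (∧-not-true⁺ (sameEdge? a b x y) e ¬same)

cover-mono : ∀ {B : Adj n} → (∀ x y → Edge B x y → Edge A x y) →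
             IsVertexCover A C → IsVertexCover B C
cover-mono B⊆A cv x y e = cv x y (B⊆A x y e)

cover-⊆ : IsVertexCover A C → C ⊆ D → IsVertexCover A D
cover-⊆ cv C⊆D x y e = Sum.map C⊆D C⊆D (cv x y e)

cover-removeEdge-swap : IsVertexCover (removeEdge A a b) C → IsVertexCover (removeEdge A b a) C
cover-removeEdge-swap {A = A} {a = a} {b = b} = cover-mono λ x y e →
  let e′ , ¬same = Edge-removeEdge⁻ A b a x y e in Edge-removeEdge⁺ A e′ (¬same ∘ ⊎-swap)

cover-removeEdge⁺ : IsVertexCover (removeEdge A a b) C → a ∈ C ⊎ b ∈ C → IsVertexCover A C
cover-removeEdge⁺ {A = A} {a = a} {b = b} cv ab∩C x y e with sameEdge? a b x y
... | no ¬same                 = cv x y (Edge-removeEdge⁺ A e ¬same)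
... | yes (inj₁ (refl , refl)) = ab∩C
... | yes (inj₂ (refl , refl)) = ⊎-swap ab∩C

cover-removeEdge-nbr : IsVertexCover (removeEdge A a b) D → a ∉ D →
                       Edge A a y → y ≢ b → y ∈ D
cover-removeEdge-nbr {A = A} {a = a} {b = b} {y = y} cv a∉D e y≢b =
  [ (λ a∈D → contradiction a∈D a∉D) , id ]′ (cv a y (Edge-removeEdge⁺ A e ¬same))
  where
  ¬same : ¬ SameEdge a b a y
  ¬same (inj₁ (_ , y≡b))     = y≢b y≡b
  ¬same (inj₂ (a≡b , y≡a)) = y≢b (trans y≡a a≡b)

Edge-sym : (G : Graph n) → Edge (adj G) x y → Edge (adj G) y x
Edge-sym {x = x} {y = y} G e = trans (Graph.sym G y x) e

Edge⇒≢ : (G : Graph n) → Edge (adj G) x y → y ≢ x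
Edge⇒≢ {x = x} G e refl with () ← trans (sym e) (irref G x)

cover-without : (G : Graph n) → IsVertexCover (adj G) C →
                (∀ y → Edge (adj G) v y → y ∈ C) → IsVertexCover (adj G) (C - v)
cover-without {v = v} G cv nbrs x y e with x ≟ v | y ≟ v
... | yes refl | _        = inj₂ (x∈p∧x≢y⇒x∈p-y (nbrs y e) (Edge⇒≢ G e))
... | _        | yes refl = inj₁ (x∈p∧x≢y⇒x∈p-y (nbrs x e′) (Edge⇒≢ G e′))
  where e′ = Edge-sym G e
... | no x≢v   | no y≢v   =
  Sum.map (λ x∈C → x∈p∧x≢y⇒x∈p-y x∈C x≢v) (λ y∈C → x∈p∧x≢y⇒x∈p-y y∈C y≢v) (cv x y e)

∣p∪q∣≤∣p∣+∣q∣ : (p q : Subset n) → ∣ p ∪ q ∣ ≤ ∣ p ∣ + ∣ q ∣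
∣p∪q∣≤∣p∣+∣q∣ []            []            = z≤n
∣p∪q∣≤∣p∣+∣q∣ (inside  ∷ p) (t ∷ q)       =
  s≤s (≤-trans (∣p∪q∣≤∣p∣+∣q∣ p q) (+-monoʳ-≤ ∣ p ∣ (∣p∣≤∣x∷p∣ t q)))
∣p∪q∣≤∣p∣+∣q∣ (outside ∷ p) (inside  ∷ q) =
  ≤-trans (s≤s (∣p∪q∣≤∣p∣+∣q∣ p q)) (≤-reflexive (sym (+-suc ∣ p ∣ ∣ q ∣)))
∣p∪q∣≤∣p∣+∣q∣ (outside ∷ p) (outside ∷ q) = ∣p∪q∣≤∣p∣+∣q∣ p q

∣p∪⁅x⁆∣≤1+∣p∣ : (p : Subset n) (x : Fin n) → ∣ p ∪ ⁅ x ⁆ ∣ ≤ suc ∣ p ∣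
∣p∪⁅x⁆∣≤1+∣p∣ p x = ≤-trans (∣p∪q∣≤∣p∣+∣q∣ p ⁅ x ⁆)
  (≤-reflexive (trans (cong (∣ p ∣ +_) (∣⁅x⁆∣≡1 x)) (+-comm ∣ p ∣ 1)))

vertexCover? : (A : Adj n) (C : Subset n) → Dec (IsVertexCover A C)
vertexCover? A C = all? λ x → all? λ y → (A x y Bool.≟ true) →-dec ((x ∈? C) ⊎-dec (y ∈? C))

minVCSize-below : (A : Adj n) (m : ℕ) → IsVertexCover A C → ∣ C ∣ ≤ m → Σ ℕ (IsMinVCSize A)
minVCSize-below {C = C} A zero    cv C≤0 = ∣ C ∣ , (C , cv , refl) , λ _ _ → ≤-trans C≤0 z≤n
minVCSize-below {C = C} A (suc m) cv C≤1+m
  with anySubset? (λ D → vertexCover? A D ×-dec (∣ D ∣ ≤? m))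
... | yes (D , cvD , D≤m) = minVCSize-below A m cvD D≤m
... | no none = ∣ C ∣ , (C , cv , refl) ,
  λ D cvD → ≤-trans C≤1+m (≰⇒> λ D≤m → none (D , cvD , D≤m))

minVCSize : (A : Adj n) → Σ ℕ (IsMinVCSize A)
minVCSize {n} A = minVCSize-below A n (λ _ _ _ → inj₁ ∈⊤) (≤-reflexive (∣⊤∣≡n n))

smallCover-avoids : IsMinVCSize A k → IsVertexCover (removeEdge A a b) D → ∣ D ∣ < k →
                    a ∉ D × b ∉ D
smallCover-avoids {D = D} min cv D<k =
  (λ a∈D → ≤⇒≯ (proj₂ min D (cover-removeEdge⁺ cv (inj₁ a∈D))) D<k) ,
  (λ b∈D → ≤⇒≯ (proj₂ min D (cover-removeEdge⁺ cv (inj₂ b∈D))) D<k)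

vcIrreducible-smallCover : VCIrreducible A → IsMinVCSize A k → Edge A a b →
  Σ[ D ∈ Subset _ ] IsVertexCover (removeEdge A a b) D × ∣ D ∣ < k
vcIrreducible-smallCover {A = A} {k = k} {a = a} {b = b} (_ , irr) min e
  with minVCSize (removeEdge A a b)
... | _ , (D , cvD , refl) , min′ = D , cvD , irr a b e k ∣ D ∣ min ((D , cvD , refl) , min′)

tailAdj : Adj (suc n) → Adj n
tailAdj B x y = B (suc x) (suc y)

cover-tail : ∀ {B : Adj (suc n)} {s} → IsVertexCover B (s ∷ C) → IsVertexCover (tailAdj B) C
cover-tail cv x y e = Sum.map drop-there drop-there (cv (suc x) (suc y) e)

cover-inside∷ : ∀ {B : Adj (suc n)} → IsVertexCover (tailAdj B) C → IsVertexCover B (inside ∷ C)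
cover-inside∷ cv zero    _       _ = inj₁ here
cover-inside∷ cv (suc x) zero    _ = inj₂ here
cover-inside∷ cv (suc x) (suc y) e = Sum.map there there (cv x y e)

tailAdj-removeEdge : ∀ (B : Adj (suc n)) a b x y →
                     Edge (tailAdj (removeEdge B (suc a) (suc b))) x y →
                     Edge (removeEdge (tailAdj B) a b) x y
tailAdj-removeEdge B a b x y e =
  let e′ , ¬same = Edge-removeEdge⁻ B (suc a) (suc b) (suc x) (suc y) e
  in Edge-removeEdge⁺ (tailAdj B) e′
       (¬same ∘ Sum.map (Product.map (cong suc) (cong suc)) (Product.map (cong suc) (cong suc)))

module _ {A : Adj n} {v : Fin n} where

  twin-self : Edge (parAdj A v) zero (suc v)
  twin-self with v ≟ v
  ... | yes _   = Bool.∨-zeroʳ (A v v)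
  ... | no v≢v = contradiction refl v≢v

  twin-nbr : Edge A v y → Edge (parAdj A v) zero (suc y)
  twin-nbr e rewrite e = refl

  twin⁻ : Edge (parAdj A v) zero (suc y) → Edge A v y ⊎ y ≡ v
  twin⁻ {y} e with A v y | y ≟ v
  ... | true  | _        = inj₁ refl
  ... | false | yes y≡v = inj₂ y≡v

  twin-nbr⁻ : Edge (parAdj A v) zero (suc y) → y ≢ v → Edge A v y
  twin-nbr⁻ e y≢v = [ id , (λ y≡v → contradiction y≡v y≢v) ]′ (twin⁻ e)

  parAdj-connected : Connected A → Connected (parAdj A v)
  parAdj-connected conn zero    zero    = ε
  parAdj-connected conn zero    (suc y) = twin-self ◅ gmap suc id (conn v y)
  parAdj-connected conn (suc x) zero    = gmap suc id (conn x v) ◅◅ (twin-self ◅ ε)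
  parAdj-connected conn (suc x) (suc y) = gmap suc id (conn x y)

  cover-removeTwinEdge : IsVertexCover A C →
    (∀ {y} → Edge (parAdj A v) zero (suc y) → y ≢ t → y ∈ C) →
    IsVertexCover (removeEdge (parAdj A v) zero (suc t)) (outside ∷ C)
  cover-removeTwinEdge {t = t} cv twins zero zero e
    with () ← proj₁ (Edge-removeEdge⁻ (parAdj A v) zero (suc t) zero zero e)
  cover-removeTwinEdge {t = t} cv twins zero (suc y) e =
    let e′ , ¬same = Edge-removeEdge⁻ (parAdj A v) zero (suc t) zero (suc y) e
    in inj₂ (there (twins e′ (λ y≡t → ¬same (inj₁ (refl , cong suc y≡t)))))
  cover-removeTwinEdge {t = t} cv twins (suc y) zero e =
    let e′ , ¬same = Edge-removeEdge⁻ (parAdj A v) zero (suc t) (suc y) zero e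
    in inj₁ (there (twins e′ (λ y≡t → ¬same (inj₂ (cong suc y≡t , refl)))))
  cover-removeTwinEdge {t = t} cv twins (suc x) (suc y) e =
    let e′ , _ = Edge-removeEdge⁻ (parAdj A v) zero (suc t) (suc x) (suc y) e
    in Sum.map there there (cv x y e′)

  module _ {k : ℕ} (irr : VCIrreducible A) (min : IsMinVCSize A k) where

    TwinEdgeCover : Fin n → Set
    TwinEdgeCover t = Σ[ C ∈ Subset n ] IsVertexCover A C ×
      (∀ {y} → Edge (parAdj A v) zero (suc y) → y ≢ t → y ∈ C) × ∣ C ∣ ≤ k

    twinEdgeCover-via : Edge A v w → SameEdge v w s t → TwinEdgeCover t
    twinEdgeCover-via {w = w} {s = s} {t = t} e st with vcIrreducible-smallCover irr min e
    ... | D , cvD , D<k = D ∪ ⁅ s ⁆ , cover , twins , size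
      where
      v∉D : v ∉ D
      v∉D = proj₁ (smallCover-avoids min cvD D<k)

      s∈C : s ∈ D ∪ ⁅ s ⁆
      s∈C = q⊆p∪q D ⁅ s ⁆ (x∈⁅x⁆ s)

      cover : IsVertexCover A (D ∪ ⁅ s ⁆)
      cover = cover-removeEdge⁺ (cover-⊆ cvD (p⊆p∪q ⁅ s ⁆))
        (Sum.map (λ s≡v → subst (_∈ D ∪ ⁅ s ⁆) s≡v s∈C)
                 (λ s≡w → subst (_∈ D ∪ ⁅ s ⁆) s≡w s∈C) (Sum.map proj₁ proj₁ st))

      twins : ∀ {y} → Edge (parAdj A v) zero (suc y) → y ≢ t → y ∈ D ∪ ⁅ s ⁆
      twins {y} e′ y≢t with y ≟ s
      ... | yes refl = s∈C
      ... | no y≢s   =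
        let y≢v , y≢w = SameEdge-others st y≢s y≢t
        in p⊆p∪q ⁅ s ⁆ (cover-removeEdge-nbr cvD v∉D (twin-nbr⁻ e′ y≢v) y≢w)

      size : ∣ D ∪ ⁅ s ⁆ ∣ ≤ k
      size = ≤-trans (∣p∪⁅x⁆∣≤1+∣p∣ D s) D<k

    -- When v is isolated the only edge at the new vertex is the one being removed.
    twinEdgeCover : Edge (parAdj A v) zero (suc t) → TwinEdgeCover t
    twinEdgeCover e with twin⁻ e
    ... | inj₁ e′   = twinEdgeCover-via e′ (inj₁ (refl , refl))
    ... | inj₂ refl with any? (λ w → A v w Bool.≟ true)
    ...   | yes (w , e′) = twinEdgeCover-via e′ (inj₂ (refl , refl))
    ...   | no isolated  = let C , cv , C≡k = proj₁ min
      in C , cv , (λ e′ y≢v → contradiction (_ , twin-nbr⁻ e′ y≢v) isolated) , ≤-reflexive C≡k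

    parAdj-removeEdge-cover : ∀ a b → Edge (parAdj A v) a b →
      Σ[ C ∈ Subset (suc n) ] IsVertexCover (removeEdge (parAdj A v) a b) C × ∣ C ∣ ≤ k
    parAdj-removeEdge-cover zero    zero    ()
    parAdj-removeEdge-cover zero    (suc t) e =
      let C , cv , twins , C≤k = twinEdgeCover e
      in outside ∷ C , cover-removeTwinEdge cv twins , C≤k
    parAdj-removeEdge-cover (suc t) zero    e =
      let C , cv , C≤k = parAdj-removeEdge-cover zero (suc t) e
      in C , cover-removeEdge-swap cv , C≤k
    parAdj-removeEdge-cover (suc i) (suc j) e =
      let D , cvD , D<k = vcIrreducible-smallCover irr min e
      in inside ∷ D , cover-inside∷ (cover-mono (tailAdj-removeEdge (parAdj A v) i j) cvD) , D<k

parAdj-cover-size : (G : Graph n) → IsMinVCSize (adj G) k →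
                    IsVertexCover (parAdj (adj G) v) C → k < ∣ C ∣
parAdj-cover-size {C = inside ∷ C} G min cv = s≤s (proj₂ min C (cover-tail cv))
parAdj-cover-size {v = v} {C = outside ∷ C} G min cv =
  ≤-<-trans (proj₂ min (C - v) (cover-without G (cover-tail cv) nbrs∈C))
            (x∈p⇒∣p-x∣<∣p∣ (twin∈C (twin-self {A = adj G})))
  where
  twin∈C : Edge (parAdj (adj G) v) zero (suc y) → y ∈ C
  twin∈C {y} e = [ (λ ()) , drop-there ]′ (cv zero (suc y) e)

  nbrs∈C : ∀ y → Edge (adj G) v y → y ∈ C
  nbrs∈C y e = twin∈C (twin-nbr {A = adj G} e)

parAdj-vcIrreducible : (G : Graph n) (v : Fin n) →
                       VCIrreducible (adj G) → VCIrreducible (parAdj (adj G) v)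
parAdj-vcIrreducible G v irr = parAdj-connected (proj₁ irr) , decrease
  where
  decrease : ∀ a b → Edge (parAdj (adj G) v) a b → ∀ k⁺ k′ →
             IsMinVCSize (parAdj (adj G) v) k⁺ →
             IsMinVCSize (removeEdge (parAdj (adj G) v) a b) k′ → k′ < k⁺
  decrease a b e k⁺ k′ min⁺ min′ =
    let k , min          = minVCSize (adj G)
        C , cv , C≤k     = parAdj-removeEdge-cover irr min a b e
        C⁺ , cv⁺ , C⁺≡k⁺ = proj₁ min⁺
    in ≤-<-trans (≤-trans (proj₂ min′ C cv) C≤k)
                 (<-≤-trans (parAdj-cover-size G min cv⁺) (≤-reflexive C⁺≡k⁺))

theorem9 : ∀ (n : ℕ) (G : Graph n) (v : Fin n) →
    Connected (adj G) → VCIrreducible (adj G) →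
    Connected (parAdj (adj G) v) × VCIrreducible (parAdj (adj G) v)
theorem9 n G v conn irr = parAdj-connected conn , parAdj-vcIrreducible G v irr
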